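{- Let $n\ge2$ and let $z=z^{ -1}\in\tilde S_n$. If $(a_1,a_2,\dots,a_l)$ (each $a_j\in[n]$) is an involution word for $z$, then an index $i\in[l]$ is a commutation if and only if $a_i$ and $a_i+1$ are fixed points of $y:=s_{a_{i-1}}\circ\cdots\circ s_{a_2}\circ s_{a_1}\circ s_{a_2}\circ\cdots\circ s_{a_{i-1}}$, in which case $s_{a_i}\circ y\circ s_{a_i}$ interchanges $a_i$ and $a_i+1$ (i.e. $(a_i,a_i+1)$ is a cycle of it).
   Context: $\tilde S_n$ is the affine symmetric group of bijections $w:\mathbb{Z}\to\mathbb{Z}$ with $w(i+n)=w(i)+n$ for all $i$ and $\sum_{i=1}^n w(i)=\sum_{i=1}^n i$; for $i\in\mathbb{Z}$, $s_i$ interchanges $i+nk$ and $i+1+nk$ for all $k\in\mathbb{Z}$ and fixes other integers; $S=\{s_1,\dots,s_n\}$ is a Coxeter generating set, with $\ell(ws_i)<\ell(w)$ iff $w(i)>w(i+1)$. Take $*=\mathrm{id}$. The Demazure product $\circ$ is the unique associative operation with $v\circ w=vw$ if $\ell(vw)=\ell(v)+\ell(w)$ and $s\circ s=s$ for $s\in S$. A word $(a_1,\dots,a_l)$ is an involution word for $z$ if it is a minimal-length sequence with $z=s_{a_l}\circ\cdots\circ s_{a_1}\circ\cdots\circ s_{a_l}$; index $i$ is a commutation if $s_{a_i}$ commutes with $s_{a_{i-1}}\circ\cdots\circ s_{a_1}\circ\cdots\circ s_{a_{i-1}}$. -}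

module Defs where

open import Data.Nat as ℕ using (ℕ; zero; suc; NonZero)
open import Data.Integer as ℤ using (ℤ; +_; _+_; _-_; _%ℕ_)
open import Data.Bool using (Bool; true; false; if_then_else_)
open import Data.List using (List; []; _∷_; foldl; length; lookup; take)
open import Data.List.Relation.Unary.All using (All)
open import Data.Product using (_×_)
open import Data.Fin using (Fin; toℕ)
open import Relation.Nullary.Decidable using (does)
open import Relation.Binary.PropositionalEquality using (_≡_)
open import Function using (_∘_)

Σ₁ : ℕ → (ℤ → ℤ) → ℤ
Σ₁ zero    f = + 0
Σ₁ (suc m) f = Σ₁ m f + f (+ suc m)

record AffPerm (n : ℕ) : Set where
  field
    fn       : ℤ → ℤ
    inv      : ℤ → ℤ
    inv-fn   : ∀ x → inv (fn x) ≡ x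
    fn-inv   : ∀ x → fn (inv x) ≡ x
    periodic : ∀ x → fn (x + + n) ≡ fn x + + n
    window   : Σ₁ n fn ≡ Σ₁ n (λ i → i)
open AffPerm public

-- Raw affine permutations (a function together with its inverse); used to
-- compute Demazure products of generators, which always land in S̃_n.
record Raw : Set where
  constructor raw
  field
    rfn  : ℤ → ℤ
    rinv : ℤ → ℤ
open Raw public

idR : Raw
idR = raw (λ x → x) (λ x → x)

_·_ : Raw → Raw → Raw
v · w = raw (rfn v ∘ rfn w) (rinv w ∘ rinv v)

sfun : (n : ℕ) .{{_ : NonZero n}} → ℤ → ℤ → ℤ
sfun n i x =
  if does ((x %ℕ n) ℕ.≟ (i %ℕ n)) then x + + 1
  else if does ((x %ℕ n) ℕ.≟ ((i + + 1) %ℕ n)) then x - + 1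
  else x

sR : (n : ℕ) .{{_ : NonZero n}} → ℕ → Raw
sR n a = raw (sfun n (+ a)) (sfun n (+ a))

-- Right Demazure product by a generator:  w ∘ s_a = w if ℓ(w s_a) < ℓ(w)
-- (i.e. w(a) > w(a+1)), and w s_a otherwise.
demR : (n : ℕ) .{{_ : NonZero n}} → Raw → ℕ → Raw
demR n w a =
  if does (rfn w (+ a + + 1) ℤ.<? rfn w (+ a)) then w else w · sR n a

-- Left Demazure product by a generator:  s_a ∘ w = w if ℓ(s_a w) < ℓ(w)
-- (i.e. w⁻¹(a) > w⁻¹(a+1)), and s_a w otherwise.
demL : (n : ℕ) .{{_ : NonZero n}} → ℕ → Raw → Raw
demL n a w =
  if does (rinv w (+ a + + 1) ℤ.<? rinv w (+ a)) then w else sR n a · w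

conjDem : (n : ℕ) .{{_ : NonZero n}} → Raw → ℕ → Raw
conjDem n y a = demL n a (demR n y a)

-- For a word (a_1,…,a_l):  s_{a_l} ∘ ⋯ ∘ s_{a_1} ∘ ⋯ ∘ s_{a_l}  (with * = id;
-- the empty word gives id).
invDem : (n : ℕ) .{{_ : NonZero n}} → List ℕ → Raw
invDem n = foldl (conjDem n) idR

InRange : ℕ → List ℕ → Set
InRange n = All (λ a → 1 ℕ.≤ a × a ℕ.≤ n)

Realises : (n : ℕ) .{{_ : NonZero n}} → List ℕ → AffPerm n → Set
Realises n as z = ∀ x → rfn (invDem n as) x ≡ fn z x

InvolutionWord : (n : ℕ) .{{_ : NonZero n}} → List ℕ → AffPerm n → Set
InvolutionWord n as z =
  InRange n as × Realises n as z ×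
  (∀ bs → InRange n bs → Realises n bs z → length as ℕ.≤ length bs)

IsInvolution : ∀ {n} → AffPerm n → Set
IsInvolution z = ∀ x → fn z (fn z x) ≡ x

-- index k (0-based; the paper's index i = k+1) is a commutation:
-- s_{a_i} commutes with y = s_{a_{i-1}} ∘ ⋯ ∘ s_{a_1} ∘ ⋯ ∘ s_{a_{i-1}}
IsCommutation : (n : ℕ) .{{_ : NonZero n}} → (as : List ℕ) → Fin (length as) → Set
IsCommutation n as k =
  ∀ x → rfn (sR n (lookup as k) · invDem n (take (toℕ k) as)) x
      ≡ rfn (invDem n (take (toℕ k) as) · sR n (lookup as k)) x

Fixes : Raw → ℤ → Set
Fixes y p = rfn y p ≡ p

module Submission where

-- Each prefix product y = s_{a_{i-1}} ∘ ⋯ ∘ s_{a_1} ∘ ⋯ ∘ s_{a_{i-1}} is an involution commuting with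
-- translation by n, and minimality of the word forces y(a) < y(a+1) for a = a_i (otherwise
-- s_a ∘ y ∘ s_a = y and the letter a_i could be deleted).  If s_a commutes with y, then
-- s_a(y(a)) = y(a+1) > y(a), so y(a) ≡ a mod n; an n-periodic involution moving a point by a multiple
-- of n fixes it, so y fixes a and a+1.  Conversely, if y fixes a and a+1 it fixes their residue
-- classes and preserves the complement, hence commutes with s_a, and then s_a ∘ y ∘ s_a = y s_a,
-- which interchanges a and a+1.

open import Defs
open import Data.Bool using (true; false; T; if_then_else_)
open import Data.Empty using (⊥-elim)
open import Data.Fin as Fin using (Fin; toℕ)
open import Data.List using (List; []; _∷_; foldl; length; lookup; take; removeAt)
open import Data.List.Properties using (take-suc; foldl-∷ʳ; length-removeAt′)
open import Data.List.Relation.Unary.All using (All; []; _∷_)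
open import Data.Integer as ℤ using (ℤ; +_; -[1+_]; _+_; _-_; _*_; -_; _%ℕ_; _/ℕ_; _<_; _≤_; ∣_∣)
import Data.Integer.Properties as ℤ
open import Algebra.Properties.AbelianGroup ℤ.+-0-abelianGroup using () renaming (∙-cancelˡ to +-cancelˡ)
open import Data.Integer.DivMod using (a≡a%ℕn+[a/ℕn]*n; n%ℕd<d)
open import Data.Integer.Tactic.RingSolver using (solve-∀)
open import Data.Nat as ℕ using (ℕ; suc; NonZero)
import Data.Nat.Properties as ℕ
open import Data.Nat.DivMod using ([m+kn]%n≡m%n; m<n⇒m%n≡m)
open import Data.Product using (_×_; _,_; ∃-syntax; uncurry)
open import Function using (_∘_)
open import Function.Bundles using (_⇔_; mk⇔)
open import Relation.Binary.PropositionalEquality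
open import Relation.Nullary using (¬_; yes; no)
open import Relation.Nullary.Decidable using (dec-true; dec-false; toSum)
open import Data.Sum using (inj₁; inj₂)

Interchanges : Raw → ℤ → ℤ → Set
Interchanges w p q = rfn w p ≡ q × rfn w q ≡ p

module Residues (n : ℕ) .{{_ : NonZero n}} where

  open ≡-Reasoning

  private
    N : ℤ
    N = + n

    residue-unique : ∀ {r r'} d → r ℕ.< n → r' ℕ.< n → + r ≡ + r' + d * N → r ≡ r'
    residue-unique {r} {r'} (+ m) r<n r'<n eq = begin
      r                      ≡⟨ m<n⇒m%n≡m r<n ⟨
      r ℕ.% n                ≡⟨ cong (ℕ._% n) (ℤ.+-injective (trans eq (sym as-pos))) ⟩
      (r' ℕ.+ m ℕ.* n) ℕ.% n ≡⟨ [m+kn]%n≡m%n r' m n ⟩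
      r' ℕ.% n               ≡⟨ m<n⇒m%n≡m r'<n ⟩
      r'                     ∎
      where
        as-pos : + (r' ℕ.+ m ℕ.* n) ≡ + r' + + m * N
        as-pos = trans (ℤ.pos-+ r' (m ℕ.* n)) (cong (_+_ (+ r')) (ℤ.pos-* m n))
    residue-unique {r} {r'} -[1+ m ] r<n r'<n eq =
      sym (residue-unique (+ suc m) r'<n r<n (begin
        + r'                                  ≡⟨ shift-back (+ r') (+ suc m) N ⟩
        + r' + - (+ suc m) * N + + suc m * N ≡⟨ cong (_+ + suc m * N) eq ⟨
        + r + + suc m * N                     ∎))
      where
        shift-back : ∀ x d M → x ≡ x + - d * M + d * M
        shift-back = solve-∀

  %ℕ-shift : ∀ x y k → x ≡ y + k * N → x %ℕ n ≡ y %ℕ n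
  %ℕ-shift x y k eq = residue-unique (qy + k - qx) (n%ℕd<d x n) (n%ℕd<d y n) (begin
    + rx                            ≡⟨ isolate (+ rx) qx N ⟩
    + rx + qx * N - qx * N          ≡⟨ cong (_- qx * N) (trans (sym (a≡a%ℕn+[a/ℕn]*n x n)) eq) ⟩
    y + k * N - qx * N              ≡⟨ cong (λ t → t + k * N - qx * N) (a≡a%ℕn+[a/ℕn]*n y n) ⟩
    + ry + qy * N + k * N - qx * N  ≡⟨ regroup (+ ry) qy k qx N ⟩
    + ry + (qy + k - qx) * N        ∎)
    where
      rx = x %ℕ n ; qx = x /ℕ n ; ry = y %ℕ n ; qy = y /ℕ n
      isolate : ∀ r q M → r ≡ r + q * M - q * M
      isolate = solve-∀
      regroup : ∀ r q k q' M → r + q * M + k * M - q' * M ≡ r + (q + k - q') * M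
      regroup = solve-∀

  %ℕ-≡⇒shift : ∀ x y → x %ℕ n ≡ y %ℕ n → ∃[ k ] x ≡ y + k * N
  %ℕ-≡⇒shift x y eq = qx - qy , (begin
    x                            ≡⟨ a≡a%ℕn+[a/ℕn]*n x n ⟩
    + (x %ℕ n) + qx * N          ≡⟨ cong (λ r → + r + qx * N) eq ⟩
    + ry + qx * N                ≡⟨ regroup (+ ry) qx qy N ⟩
    + ry + qy * N + (qx - qy) * N ≡⟨ cong (_+ (qx - qy) * N) (a≡a%ℕn+[a/ℕn]*n y n) ⟨
    y + (qx - qy) * N            ∎)
    where
      qx = x /ℕ n ; ry = y %ℕ n ; qy = y /ℕ n
      regroup : ∀ r q q' M → r + q * M ≡ r + q' * M + (q - q') * M
      regroup = solve-∀

  %ℕ-+-cong : ∀ x y c → x %ℕ n ≡ y %ℕ n → (x + c) %ℕ n ≡ (y + c) %ℕ n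
  %ℕ-+-cong x y c eq with %ℕ-≡⇒shift x y eq
  ... | k , x≡y+kN = %ℕ-shift (x + c) (y + c) k (trans (cong (_+ c) x≡y+kN) (swap y (k * N) c))
    where
      swap : ∀ a b c → a + b + c ≡ a + c + b
      swap = solve-∀

  %ℕ-pred-cong : ∀ x y → x %ℕ n ≡ (y + + 1) %ℕ n → (x - + 1) %ℕ n ≡ y %ℕ n
  %ℕ-pred-cong x y eq = trans (%ℕ-+-cong x (y + + 1) (- + 1) eq) (cong (_%ℕ n) (+1-1 y))
    where
      +1-1 : ∀ y → y + + 1 - + 1 ≡ y
      +1-1 = solve-∀

  %ℕ-suc-≢ : 2 ℕ.≤ n → ∀ x → (x + + 1) %ℕ n ≢ x %ℕ n
  %ℕ-suc-≢ 2≤n x eq with %ℕ-≡⇒shift (x + + 1) x eq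
  ... | k , x+1≡x+kN = ℕ.<⇒≢ 2≤n (sym n≡1)
    where
      1≡kN : + 1 ≡ k * N
      1≡kN = +-cancelˡ x (+ 1) (k * N) x+1≡x+kN
      n≡1 : n ≡ 1
      n≡1 = ℕ.m*n≡1⇒n≡1 ∣ k ∣ n (sym (trans (cong ∣_∣ 1≡kN) (ℤ.abs-* k N)))

module Demazure (n : ℕ) .{{_ : NonZero n}} where

  demR-descent : ∀ w a → rfn w (+ a + + 1) < rfn w (+ a) → demR n w a ≡ w
  demR-descent w a d = cong (if_then w else w · sR n a) (dec-true (rfn w (+ a + + 1) ℤ.<? rfn w (+ a)) d)

  demR-ascent : ∀ w a → ¬ rfn w (+ a + + 1) < rfn w (+ a) → demR n w a ≡ w · sR n a
  demR-ascent w a nd = cong (if_then w else w · sR n a) (dec-false (rfn w (+ a + + 1) ℤ.<? rfn w (+ a)) nd)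

  demL-descent : ∀ a w → rinv w (+ a + + 1) < rinv w (+ a) → demL n a w ≡ w
  demL-descent a w d = cong (if_then w else sR n a · w) (dec-true (rinv w (+ a + + 1) ℤ.<? rinv w (+ a)) d)

  demL-ascent : ∀ a w → ¬ rinv w (+ a + + 1) < rinv w (+ a) → demL n a w ≡ sR n a · w
  demL-ascent a w nd = cong (if_then w else sR n a · w) (dec-false (rinv w (+ a + + 1) ℤ.<? rinv w (+ a)) nd)

module Generators (n : ℕ) .{{_ : NonZero n}} (2≤n : 2 ℕ.≤ n) where

  open Residues n
  open ≡-Reasoning

  s : ℕ → ℤ → ℤ
  s a = sfun n (+ a)

  private
    ≡ᵇ-true : ∀ {i j} → (i ℕ.≡ᵇ j) ≡ true → i ≡ j
    ≡ᵇ-true {i} {j} eq = ℕ.≡ᵇ⇒≡ i j (subst T (sym eq) _)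

    ≡ᵇ-false : ∀ {i j} → (i ℕ.≡ᵇ j) ≡ false → i ≢ j
    ≡ᵇ-false {i} {j} eq i≡j = subst T eq (ℕ.≡⇒≡ᵇ i j i≡j)

  -- sfun's tests normalise to ℕ._≡ᵇ_ (not ℕ._≟_), so that is what these proofs split on.
  s-at : ∀ a x → x %ℕ n ≡ + a %ℕ n → s a x ≡ x + + 1
  s-at a x p with x %ℕ n ℕ.≡ᵇ a ℕ.% n in eq
  ... | true  = refl
  ... | false = ⊥-elim (≡ᵇ-false eq p)

  s-at-suc : ∀ a x → x %ℕ n ≢ + a %ℕ n → x %ℕ n ≡ (+ a + + 1) %ℕ n → s a x ≡ x - + 1
  s-at-suc a x p q with x %ℕ n ℕ.≡ᵇ a ℕ.% n in eq | x %ℕ n ℕ.≡ᵇ (a ℕ.+ 1) ℕ.% n in eq′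
  ... | true  | _     = ⊥-elim (p (≡ᵇ-true eq))
  ... | false | true  = refl
  ... | false | false = ⊥-elim (≡ᵇ-false eq′ q)

  s-away : ∀ a x → x %ℕ n ≢ + a %ℕ n → x %ℕ n ≢ (+ a + + 1) %ℕ n → s a x ≡ x
  s-away a x p q with x %ℕ n ℕ.≡ᵇ a ℕ.% n in eq | x %ℕ n ℕ.≡ᵇ (a ℕ.+ 1) ℕ.% n in eq′
  ... | true  | _     = ⊥-elim (p (≡ᵇ-true eq))
  ... | false | true  = ⊥-elim (q (≡ᵇ-true eq′))
  ... | false | false = refl

  data Position (a : ℕ) (x : ℤ) : Set where
    at-a     : x %ℕ n ≡ + a %ℕ n → Position a x
    at-suc-a : x %ℕ n ≢ + a %ℕ n → x %ℕ n ≡ (+ a + + 1) %ℕ n → Position a x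
    away     : x %ℕ n ≢ + a %ℕ n → x %ℕ n ≢ (+ a + + 1) %ℕ n → Position a x

  position : ∀ a x → Position a x
  position a x with x %ℕ n ℕ.≟ + a %ℕ n | x %ℕ n ℕ.≟ (+ a + + 1) %ℕ n
  ... | yes p | _     = at-a p
  ... | no p  | yes q = at-suc-a p q
  ... | no p  | no q  = away p q

  private
    +1-1 : ∀ x → x + + 1 - + 1 ≡ x
    +1-1 = solve-∀

    -1+1 : ∀ x → x - + 1 + + 1 ≡ x
    -1+1 = solve-∀

    x-1≤x : ∀ {x} → x - + 1 ≤ x
    x-1≤x = ℤ.i≤j⇒i-k≤j (+ 1) ℤ.≤-refl

    <⇒≤-1 : ∀ {u v} → u < v → u ≤ v - + 1
    <⇒≤-1 {u} {v} u<v = subst (u ≤_) (ℤ.+-comm (- + 1) v) (ℤ.i<j⇒i≤pred[j] u<v)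

    <+1⇒≤ : ∀ {u v} → u < v + + 1 → u ≤ v
    <+1⇒≤ {u} {v} u<v+1 = subst (u ≤_) (cancel v) (ℤ.i<j⇒i≤pred[j] u<v+1)
      where
        cancel : ∀ v → - + 1 + (v + + 1) ≡ v
        cancel = solve-∀

  s-a : ∀ a → s a (+ a) ≡ + a + + 1
  s-a a = s-at a (+ a) refl

  s-suc-a : ∀ a → s a (+ a + + 1) ≡ + a
  s-suc-a a = trans (s-at-suc a (+ a + + 1) (%ℕ-suc-≢ 2≤n (+ a)) refl) (+1-1 (+ a))

  s-periodic : ∀ a x k → s a (x + k * + n) ≡ s a x + k * + n
  s-periodic a x k rewrite %ℕ-shift (x + k * + n) x k refl
    with x %ℕ n ℕ.≡ᵇ a ℕ.% n | x %ℕ n ℕ.≡ᵇ (a ℕ.+ 1) ℕ.% n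
  ... | true  | _     = swap x (k * + n) (+ 1)
    where
      swap : ∀ x y c → x + y + c ≡ x + c + y
      swap = solve-∀
  ... | false | true  = swap x (k * + n) (+ 1)
    where
      swap : ∀ x y c → x + y - c ≡ x - c + y
      swap = solve-∀
  ... | false | false = refl

  s-involutive : ∀ a x → s a (s a x) ≡ x
  s-involutive a x with position a x
  ... | at-a p = begin
    s a (s a x)     ≡⟨ cong (s a) (s-at a x p) ⟩
    s a (x + + 1)   ≡⟨ s-at-suc a (x + + 1) x+1≉a x+1≈a+1 ⟩
    x + + 1 - + 1   ≡⟨ +1-1 x ⟩
    x               ∎
    where
      x+1≈a+1 = %ℕ-+-cong x (+ a) (+ 1) p
      x+1≉a = λ x+1≈a → %ℕ-suc-≢ 2≤n (+ a) (trans (sym x+1≈a+1) x+1≈a)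
  ... | at-suc-a p q = begin
    s a (s a x)     ≡⟨ cong (s a) (s-at-suc a x p q) ⟩
    s a (x - + 1)   ≡⟨ s-at a (x - + 1) (%ℕ-pred-cong x (+ a) q) ⟩
    x - + 1 + + 1   ≡⟨ -1+1 x ⟩
    x               ∎
  ... | away p q = trans (cong (s a) (s-away a x p q)) (s-away a x p q)

  x-1≤s : ∀ a x → x - + 1 ≤ s a x
  x-1≤s a x with position a x
  ... | at-a p       = subst (x - + 1 ≤_) (sym (s-at a x p)) (ℤ.≤-trans x-1≤x (ℤ.i≤i+j x (+ 1)))
  ... | at-suc-a p q = ℤ.≤-reflexive (sym (s-at-suc a x p q))
  ... | away p q     = subst (x - + 1 ≤_) (sym (s-away a x p q)) x-1≤x

  s≤x+1 : ∀ a x → s a x ≤ x + + 1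
  s≤x+1 a x with position a x
  ... | at-a p       = ℤ.≤-reflexive (s-at a x p)
  ... | at-suc-a p q = subst (_≤ x + + 1) (sym (s-at-suc a x p q)) (ℤ.≤-trans x-1≤x (ℤ.i≤i+j x (+ 1)))
  ... | away p q     = subst (_≤ x + + 1) (sym (s-away a x p q)) (ℤ.i≤i+j x (+ 1))

  s-raises⇒at-a : ∀ a x → x < s a x → x %ℕ n ≡ + a %ℕ n
  s-raises⇒at-a a x x<sx with position a x
  ... | at-a p       = p
  ... | at-suc-a p q = ⊥-elim (ℤ.<⇒≱ (subst (x <_) (s-at-suc a x p q) x<sx) x-1≤x)
  ... | away p q     = ⊥-elim (ℤ.<-irrefl refl (subst (x <_) (s-away a x p q) x<sx))

  s-reversal : ∀ a {u v} → u < v → s a v < s a u → s a u ≡ v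
  s-reversal a {u} {v} u<v sv<su = begin
    s a u         ≡⟨ cong (s a) (sym sv≡u) ⟩
    s a (s a v)   ≡⟨ s-involutive a v ⟩
    v             ∎
    where
      sv≡u : s a v ≡ u
      sv≡u = ℤ.≤-antisym (<+1⇒≤ (ℤ.<-≤-trans sv<su (s≤x+1 a u)))
                         (ℤ.≤-trans (<⇒≤-1 u<v) (x-1≤s a v))

module PeriodicInvolutions (n : ℕ) .{{_ : NonZero n}} (2≤n : 2 ℕ.≤ n) where

  open Residues n
  open Generators n 2≤n
  open Demazure n
  open ≡-Reasoning

  record IsPeriodicInvolution (y : Raw) : Set where
    field
      rinv≗rfn   : ∀ x → rinv y x ≡ rfn y x
      involutive : ∀ x → rfn y (rfn y x) ≡ x
      periodic   : ∀ x k → rfn y (x + k * + n) ≡ rfn y x + k * + n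

  open IsPeriodicInvolution

  private
    a<a+1 : ∀ a → + a < + a + + 1
    a<a+1 a = ℤ.+<+ (ℕ.m<m+n a ℕ.z<s)

  module _ {y : Raw} (Y : IsPeriodicInvolution y) where

    private
      f : ℤ → ℤ
      f = rfn y

    injective : ∀ {x x′} → f x ≡ f x′ → x ≡ x′
    injective {x} {x′} eq = trans (sym (involutive Y x)) (trans (cong f eq) (involutive Y x′))

    ascent : ∀ a → ¬ f (+ a + + 1) < f (+ a) → f (+ a) < f (+ a + + 1)
    ascent a nd = ℤ.≤∧≢⇒< (ℤ.≮⇒≥ nd) (ℤ.<⇒≢ (a<a+1 a) ∘ injective)

    fixes-congruent : ∀ {p} x → Fixes y p → x %ℕ n ≡ p %ℕ n → Fixes y x
    fixes-congruent {p} x fp x≈p with %ℕ-≡⇒shift x p x≈p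
    ... | k , x≡p+kN = begin
      f x              ≡⟨ cong f x≡p+kN ⟩
      f (p + k * + n)  ≡⟨ periodic Y p k ⟩
      f p + k * + n    ≡⟨ cong (_+ k * + n) fp ⟩
      p + k * + n      ≡⟨ x≡p+kN ⟨
      x                ∎

    fixes-mod⇒fixes : ∀ p k → f p ≡ p + k * + n → Fixes y p
    fixes-mod⇒fixes p k fp≡p+kN = trans fp≡p+kN (trans (cong (_+_ p) kN≡0) (ℤ.+-identityʳ p))
      where
        twice : p + + 0 ≡ p + (k * + n + k * + n)
        twice = begin
          p + + 0                      ≡⟨ ℤ.+-identityʳ p ⟩
          p                            ≡⟨ involutive Y p ⟨
          f (f p)                      ≡⟨ cong f fp≡p+kN ⟩
          f (p + k * + n)              ≡⟨ periodic Y p k ⟩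
          f p + k * + n                ≡⟨ cong (_+ k * + n) fp≡p+kN ⟩
          p + k * + n + k * + n        ≡⟨ ℤ.+-assoc p (k * + n) (k * + n) ⟩
          p + (k * + n + k * + n)      ∎
        kN≡0 : k * + n ≡ + 0
        kN≡0 = ℤ.*-cancelˡ-≡ (+ 2) (k * + n) (+ 0)
                 (trans (double (k * + n)) (sym (+-cancelˡ p _ _ twice)))
          where
            double : ∀ i → + 2 * i ≡ i + i
            double = solve-∀

    commutes-with-s : ∀ a → Fixes y (+ a) → Fixes y (+ a + + 1) → ∀ x → f (s a x) ≡ s a (f x)
    commutes-with-s a fa fa₁ x with position a x
    ... | at-a p = begin
      f (s a x)     ≡⟨ cong f (s-at a x p) ⟩
      f (x + + 1)   ≡⟨ fixes-congruent (x + + 1) fa₁ (%ℕ-+-cong x (+ a) (+ 1) p) ⟩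
      x + + 1       ≡⟨ s-at a x p ⟨
      s a x         ≡⟨ cong (s a) (fixes-congruent x fa p) ⟨
      s a (f x)     ∎
    ... | at-suc-a p q = begin
      f (s a x)     ≡⟨ cong f (s-at-suc a x p q) ⟩
      f (x - + 1)   ≡⟨ fixes-congruent (x - + 1) fa (%ℕ-pred-cong x (+ a) q) ⟩
      x - + 1       ≡⟨ s-at-suc a x p q ⟨
      s a x         ≡⟨ cong (s a) (fixes-congruent x fa₁ q) ⟨
      s a (f x)     ∎
    ... | away p q = begin
      f (s a x)     ≡⟨ cong f (s-away a x p q) ⟩
      f x           ≡⟨ s-away a (f x) (λ fx≈a → p (back fa fx≈a)) (λ fx≈a₁ → q (back fa₁ fx≈a₁)) ⟨
      s a (f x)     ∎
      where
        back : ∀ {r} → Fixes y r → f x %ℕ n ≡ r %ℕ n → x %ℕ n ≡ r %ℕ n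
        back fr fx≈r = subst (λ t → t %ℕ n ≡ _) fx≡x fx≈r
          where
            fx≡x : f x ≡ x
            fx≡x = trans (sym (fixes-congruent (f x) fr fx≈r)) (involutive Y x)

    s-swap⇒fixes : ∀ a → f (+ a) < f (+ a + + 1) → s a (f (+ a)) ≡ f (+ a + + 1) →
                    Fixes y (+ a) × Fixes y (+ a + + 1)
    s-swap⇒fixes a u<v su≡v = fa , (begin
      f (+ a + + 1)   ≡⟨ su≡v ⟨
      s a (f (+ a))   ≡⟨ cong (s a) fa ⟩
      s a (+ a)       ≡⟨ s-a a ⟩
      + a + + 1       ∎)
      where
        u≈a : f (+ a) %ℕ n ≡ + a %ℕ n
        u≈a = s-raises⇒at-a a (f (+ a)) (subst (f (+ a) <_) (sym su≡v) u<v)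
        fa : Fixes y (+ a)
        fa = let k , u≡a+kN = %ℕ-≡⇒shift (f (+ a)) (+ a) u≈a in fixes-mod⇒fixes (+ a) k u≡a+kN

    ·s-periodicInvolution : ∀ a → Fixes y (+ a) → Fixes y (+ a + + 1) → IsPeriodicInvolution (y · sR n a)
    ·s-periodicInvolution a fa fa₁ = record
      { rinv≗rfn   = λ x → trans (cong (s a) (rinv≗rfn Y x)) (sym (commute x))
      ; involutive = λ x → trans (commute (f (s a x)))
                                 (trans (cong (s a) (involutive Y (s a x))) (s-involutive a x))
      ; periodic   = λ x k → trans (cong f (s-periodic a x k)) (periodic Y (s a x) k)
      }
      where commute = commutes-with-s a fa fa₁

    s·-·s-periodicInvolution : ∀ a → IsPeriodicInvolution (sR n a · (y · sR n a))
    s·-·s-periodicInvolution a = record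
      { rinv≗rfn   = λ x → cong (s a) (rinv≗rfn Y (s a x))
      ; involutive = λ x → begin
          s a (f (s a (s a (f (s a x)))))  ≡⟨ cong (s a ∘ f) (s-involutive a (f (s a x))) ⟩
          s a (f (f (s a x)))              ≡⟨ cong (s a) (involutive Y (s a x)) ⟩
          s a (s a x)                      ≡⟨ s-involutive a x ⟩
          x                                ∎
      ; periodic   = λ x k → begin
          s a (f (s a (x + k * + n)))      ≡⟨ cong (s a ∘ f) (s-periodic a x k) ⟩
          s a (f (s a x + k * + n))        ≡⟨ cong (s a) (periodic Y (s a x) k) ⟩
          s a (f (s a x) + k * + n)        ≡⟨ s-periodic a (f (s a x)) k ⟩
          s a (f (s a x)) + k * + n        ∎
      }

    conjDem-descent : ∀ a → f (+ a + + 1) < f (+ a) → conjDem n y a ≡ y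
    conjDem-descent a d = trans (cong (demL n a) (demR-descent y a d))
      (demL-descent a y (subst₂ _<_ (sym (rinv≗rfn Y _)) (sym (rinv≗rfn Y _)) d))

    conjDem-fixes : ∀ a → Fixes y (+ a) → Fixes y (+ a + + 1) → conjDem n y a ≡ y · sR n a
    conjDem-fixes a fa fa₁ =
      trans (cong (demL n a) (demR-ascent y a no-descent)) (demL-descent a (y · sR n a) descent)
      where
        no-descent : ¬ f (+ a + + 1) < f (+ a)
        no-descent d = ℤ.<-asym (a<a+1 a) (subst₂ _<_ fa₁ fa d)
        s-f⁻¹ : ∀ {p} → Fixes y p → s a (rinv y p) ≡ s a p
        s-f⁻¹ fp = cong (s a) (trans (rinv≗rfn Y _) fp)
        descent : s a (rinv y (+ a + + 1)) < s a (rinv y (+ a))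
        descent = subst₂ _<_ (sym (trans (s-f⁻¹ fa₁) (s-suc-a a))) (sym (trans (s-f⁻¹ fa) (s-a a))) (a<a+1 a)

    conjDem-interchanges : ∀ a → Fixes y (+ a) → Fixes y (+ a + + 1) → Interchanges (conjDem n y a) (+ a) (+ a + + 1)
    conjDem-interchanges a fa fa₁ rewrite conjDem-fixes a fa fa₁ =
      trans (cong f (s-a a)) fa₁ , trans (cong f (s-suc-a a)) fa

    -- A trivial left step leaves y · s_a, which is an involution only because y then fixes a and a + 1.
    demL-·s-periodicInvolution : ∀ a → f (+ a) < f (+ a + + 1) → IsPeriodicInvolution (demL n a (y · sR n a))
    demL-·s-periodicInvolution a u<v with toSum (rinv (y · sR n a) (+ a + + 1) ℤ.<? rinv (y · sR n a) (+ a))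
    ... | inj₁ d = subst IsPeriodicInvolution (sym (demL-descent a _ d)) (uncurry (·s-periodicInvolution a) fixed)
      where
        sv<su : s a (f (+ a + + 1)) < s a (f (+ a))
        sv<su = subst₂ (λ u v → s a u < s a v) (rinv≗rfn Y _) (rinv≗rfn Y _) d
        fixed : Fixes y (+ a) × Fixes y (+ a + + 1)
        fixed = s-swap⇒fixes a u<v (s-reversal a u<v sv<su)
    ... | inj₂ nd = subst IsPeriodicInvolution (sym (demL-ascent a _ nd)) (s·-·s-periodicInvolution a)

    conjDem-periodicInvolution : ∀ a → IsPeriodicInvolution (conjDem n y a)
    conjDem-periodicInvolution a with toSum (f (+ a + + 1) ℤ.<? f (+ a))
    ... | inj₁ d  = subst IsPeriodicInvolution (sym (conjDem-descent a d)) Y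
    ... | inj₂ nd = subst IsPeriodicInvolution (cong (demL n a) (sym (demR-ascent y a nd)))
                          (demL-·s-periodicInvolution a (ascent a nd))

  idR-periodicInvolution : IsPeriodicInvolution idR
  idR-periodicInvolution = record
    { rinv≗rfn = λ _ → refl ; involutive = λ _ → refl ; periodic = λ _ _ → refl }

  invDem-periodicInvolution : ∀ as → IsPeriodicInvolution (invDem n as)
  invDem-periodicInvolution = go idR-periodicInvolution
    where
      go : ∀ {w} → IsPeriodicInvolution w → ∀ as → IsPeriodicInvolution (foldl (conjDem n) w as)
      go W []       = W
      go W (a ∷ as) = go (conjDem-periodicInvolution W a) as

module _ {a b} {A : Set a} {B : Set b} (f : A → B → A) where

  foldl-take-suc : ∀ w xs (k : Fin (length xs)) →
                   foldl f w (take (suc (toℕ k)) xs) ≡ f (foldl f w (take (toℕ k) xs)) (lookup xs k)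
  foldl-take-suc w xs k = trans (cong (foldl f w) (take-suc xs k)) (foldl-∷ʳ f w (lookup xs k) (take (toℕ k) xs))

  foldl-removeAt-idle : ∀ w xs (k : Fin (length xs)) →
                        f (foldl f w (take (toℕ k) xs)) (lookup xs k) ≡ foldl f w (take (toℕ k) xs) →
                        foldl f w (removeAt xs k) ≡ foldl f w xs
  foldl-removeAt-idle w (x ∷ xs) Fin.zero    idle = cong (λ w′ → foldl f w′ xs) (sym idle)
  foldl-removeAt-idle w (x ∷ xs) (Fin.suc k) idle = foldl-removeAt-idle (f w x) xs k idle

All-removeAt : ∀ {a p} {A : Set a} {P : A → Set p} xs (k : Fin (length xs)) → All P xs → All P (removeAt xs k)
All-removeAt (x ∷ xs) Fin.zero    (_ ∷ pxs)  = pxs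
All-removeAt (x ∷ xs) (Fin.suc k) (px ∷ pxs) = px ∷ All-removeAt xs k pxs

module InvolutionWords (n : ℕ) .{{_ : NonZero n}} (2≤n : 2 ℕ.≤ n) where

  open PeriodicInvolutions n 2≤n

  involutionWord-ascends : ∀ {z as} → InvolutionWord n as z → (k : Fin (length as)) →
    let y = invDem n (take (toℕ k) as) ; a = lookup as k in
    ¬ rfn y (+ a + + 1) < rfn y (+ a)
  involutionWord-ascends {z} {as} (inRange , realises , minimal) k descent =
    ℕ.n≮n _ (subst (ℕ._≤ length (removeAt as k)) (length-removeAt′ as k) shorter)
    where
      idle = conjDem-descent (invDem-periodicInvolution (take (toℕ k) as)) (lookup as k) descent
      shorter : length as ℕ.≤ length (removeAt as k)
      shorter = minimal (removeAt as k) (All-removeAt as k inRange)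
        (λ x → trans (cong (λ w → rfn w x) (foldl-removeAt-idle (conjDem n) idR as k idle)) (realises x))

lemma8p1 : (n : ℕ) → .{{_ : NonZero n}} → 2 ℕ.≤ n →
    (z : AffPerm n) → IsInvolution z →
    (as : List ℕ) → InvolutionWord n as z →
    (k : Fin (length as)) →
      (IsCommutation n as k ⇔
        (Fixes (invDem n (take (toℕ k) as)) (+ lookup as k)
          × Fixes (invDem n (take (toℕ k) as)) (+ lookup as k + + 1)))
      × (IsCommutation n as k →
          (rfn (invDem n (take (suc (toℕ k)) as)) (+ lookup as k) ≡ + lookup as k + + 1)
          × (rfn (invDem n (take (suc (toℕ k)) as)) (+ lookup as k + + 1) ≡ + lookup as k))
lemma8p1 n 2≤n z _ as word k = mk⇔ commutation⇒fixes fixes⇒commutation , interchanges ∘ commutation⇒fixes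
  where
    open Generators n 2≤n
    open PeriodicInvolutions n 2≤n
    open InvolutionWords n 2≤n

    y = invDem n (take (toℕ k) as)
    a = lookup as k
    Y = invDem-periodicInvolution (take (toℕ k) as)

    commutation⇒fixes : IsCommutation n as k → Fixes y (+ a) × Fixes y (+ a + + 1)
    commutation⇒fixes commutes = s-swap⇒fixes Y a (ascent Y a (involutionWord-ascends {z} word k))
                                               (trans (commutes (+ a)) (cong (rfn y) (s-a a)))

    fixes⇒commutation : Fixes y (+ a) × Fixes y (+ a + + 1) → IsCommutation n as k
    fixes⇒commutation (fa , fa₁) x = sym (commutes-with-s Y a fa fa₁ x)

    interchanges : Fixes y (+ a) × Fixes y (+ a + + 1) →
                   Interchanges (invDem n (take (suc (toℕ k)) as)) (+ a) (+ a + + 1)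
    interchanges (fa , fa₁) = subst (λ w → Interchanges w (+ a) (+ a + + 1))
                                    (sym (foldl-take-suc (conjDem n) idR as k))
                                    (conjDem-interchanges Y a fa fa₁)
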